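{- Let $\mathcal{H}$ be a hypergraph on $n$ vertices, and let $z\ge 1$ and $t\ge 2$ be integers. Let $\mathcal{L}=\{L_v : v\in V(\mathcal{H})\}$ be an $r$-assignment for $\mathcal{H}$ (i.e. $|L_v|=r$ for all $v$), where $r = 5t(z+\lceil \ln n\rceil)$. For every $v\in V(\mathcal{H})$ let $i_v\in\{1,\dots,t\}$ be arbitrary. Then there is a partition of the palette $\mathcal{P}_{\mathcal{L}}=\bigcup_{v\in V(\mathcal{H})}L_v$ into $t$ parts $\mathcal{P}^1_{\mathcal{L}},\dots,\mathcal{P}^t_{\mathcal{L}}$ such that, writing $L_v^j := L_v\cap \mathcal{P}^j_{\mathcal{L}}$, for every $v\in V(\mathcal{H})$ we have $$9(z+\lceil\ln n\rceil) \ \ge\ |L_v^{i_v}| \ \ge\ z+\lceil \ln n\rceil.$$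
   Context: $\ln$ denotes the natural logarithm. -}

module Defs where

open import Data.Nat using (ℕ; zero; suc; _+_; _*_; _^_; _≤_; _<_)
open import Data.Nat using (_!)
open import Data.Fin using (Fin)
open import Data.Fin.Properties using (_≟_)
open import Data.List using (List; length; filter)
open import Data.Product using (Σ; _×_; ∃-syntax)
open import Relation.Nullary using (¬_)

-- T k m = m! * Σ_{j=0}^{m} k^j / j!   (a natural number)
T : ℕ → ℕ → ℕ
T k zero    = 1
T k (suc m) = suc m * T k m + k ^ suc m

-- n ≤ e^k  (as real numbers).  Since the partial sums Σ_{j≤m} k^j/j!
-- increase strictly to e^k, and e^k is irrational for k ≥ 1 (and e^0 = 1
-- is the m = 0 partial sum), n ≤ e^k iff n ≤ some partial sum.
LeExp : ℕ → ℕ → Set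
LeExp n k = ∃[ m ] (n * (m !) ≤ T k m)

IsCeilLn : ℕ → ℕ → Set
IsCeilLn n c = LeExp n c × (∀ k → k < c → ¬ LeExp n k)

Hypergraph : ℕ → Set
Hypergraph n = List (List (Fin n))

partSize : {t : ℕ} → (ℕ → Fin t) → Fin t → List ℕ → ℕ
partSize part i L = length (filter (λ c → part c ≟ i) L)

{-# OPTIONS --safe #-}
-- Put each colour of the palette into one of the t parts independently and uniformly at random. For a
-- vertex v, |L_v ∩ P^{i_v}| is then binomial with N = 5t(z + c) trials and mean 5(z + c). Markov's
-- inequality for 2^X and for 3^(-X), together with n ≤ eᶜ ≤ (11/4)ᶜ, (1 + 1/t)ᵗ ≤ 11/4 and
-- (1 - 2/(3t))ᵗ ≤ 3/5, bounds each of the two tails by less than 1/(2n), so the expected number of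
-- vertices with |L_v ∩ P^{i_v}| outside [z + c, 9(z + c)] is below 1. The method of conditional
-- expectations turns this into a partition: fix the colours one at a time, each time choosing a part
-- that does not increase the conditional expectation. All expectations are multiplied by t^N, so the
-- whole argument takes place in ℕ.
module Submission where

open import Defs
open import Data.Nat
open import Data.Nat.Properties
open import Data.Nat.Tactic.RingSolver using (solve-∀)
open import Data.Bool using (Bool; true; false; if_then_else_)
open import Data.Unit using (tt)
open import Data.Fin using (Fin; zero; suc)
open import Data.Fin.Properties using () renaming (_≟_ to _≟ᶠ_)
open import Data.List using (List; []; _∷_; length; concat; tabulate; deduplicate)
open import Data.List.Relation.Unary.All as All using (All; []; _∷_)
open import Data.List.Relation.Unary.Unique.Propositional using (Unique; []; _∷_)
open import Data.List.Membership.Propositional using (_∈_)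
open import Data.List.Relation.Unary.Any using (here; there)
open import Data.List.Membership.Propositional.Properties using (∈-concat⁺′; ∈-tabulate⁺; ∈-deduplicate⁺)
open import Data.List.Relation.Unary.Unique.DecPropositional.Properties _≟_ using (deduplicate-!)
open import Data.Maybe using (Maybe; just; nothing)
open import Data.Product using (_×_; _,_; proj₁; proj₂; ∃-syntax)
open import Function using (_∘_)
open import Relation.Binary.PropositionalEquality
open import Relation.Nullary using (yes; no; does; contradiction)
open import Relation.Nullary.Decidable using (dec-true; dec-false)
open import Algebra.Properties.Semiring.Sum +-*-semiring using (sum-syntax; ∑-comm; ∑-distrib-+; *-distribˡ-sum; sum-cong-≗)
open import Algebra.Properties.CommutativeSemigroup *-commutativeSemigroup using (x∙yz≈y∙xz; xy∙z≈y∙xz; xy∙z≈xz∙y; interchange)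
open import Algebra.Properties.CommutativeSemigroup +-commutativeSemigroup using ()
  renaming (interchange to +-interchange; x∙yz≈y∙xz to x+[y+z]≡y+[x+z])

-- Partial sums of the exponential series

antidiagonalSum : ℕ → (ℕ → ℕ → ℕ) → ℕ
antidiagonalSum zero    f = f 0 0
antidiagonalSum (suc M) f = f 0 (suc M) + antidiagonalSum M (λ i j → f (suc i) j)

antidiagonalSum-cong : ∀ M {f g : ℕ → ℕ → ℕ} → (∀ i j → i + j ≡ M → f i j ≡ g i j) →
                       antidiagonalSum M f ≡ antidiagonalSum M g
antidiagonalSum-cong zero    f≡g = f≡g 0 0 refl
antidiagonalSum-cong (suc M) f≡g =
  cong₂ _+_ (f≡g 0 (suc M) refl) (antidiagonalSum-cong M (λ i j eq → f≡g (suc i) j (cong suc eq)))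

antidiagonalSum-mono-≤ : ∀ M {f g : ℕ → ℕ → ℕ} → (∀ i j → i + j ≡ M → f i j ≤ g i j) →
                         antidiagonalSum M f ≤ antidiagonalSum M g
antidiagonalSum-mono-≤ zero    f≤g = f≤g 0 0 refl
antidiagonalSum-mono-≤ (suc M) f≤g =
  +-mono-≤ (f≤g 0 (suc M) refl) (antidiagonalSum-mono-≤ M (λ i j eq → f≤g (suc i) j (cong suc eq)))

antidiagonalSum-distrib-+ : ∀ M (f g : ℕ → ℕ → ℕ) →
  antidiagonalSum M (λ i j → f i j + g i j) ≡ antidiagonalSum M f + antidiagonalSum M g
antidiagonalSum-distrib-+ zero    f g = refl
antidiagonalSum-distrib-+ (suc M) f g = begin
  f 0 (suc M) + g 0 (suc M) + antidiagonalSum M (λ i j → f (suc i) j + g (suc i) j)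
    ≡⟨ cong (f 0 (suc M) + g 0 (suc M) +_) (antidiagonalSum-distrib-+ M _ _) ⟩
  f 0 (suc M) + g 0 (suc M) + (antidiagonalSum M (λ i j → f (suc i) j) + antidiagonalSum M (λ i j → g (suc i) j))
    ≡⟨ +-interchange (f 0 (suc M)) (g 0 (suc M)) _ _ ⟩
  antidiagonalSum (suc M) f + antidiagonalSum (suc M) g ∎
  where open ≡-Reasoning

*-distribˡ-antidiagonalSum : ∀ M a (f : ℕ → ℕ → ℕ) →
  a * antidiagonalSum M f ≡ antidiagonalSum M (λ i j → a * f i j)
*-distribˡ-antidiagonalSum zero    a f = refl
*-distribˡ-antidiagonalSum (suc M) a f =
  trans (*-distribˡ-+ a (f 0 (suc M)) _) (cong (a * f 0 (suc M) +_) (*-distribˡ-antidiagonalSum M a _))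

antidiagonalSum-sucʳ : ∀ M (f : ℕ → ℕ → ℕ) →
  antidiagonalSum (suc M) f ≡ antidiagonalSum M (λ i j → f i (suc j)) + f (suc M) 0
antidiagonalSum-sucʳ zero    f = refl
antidiagonalSum-sucʳ (suc M) f =
  trans (cong (f 0 (suc (suc M)) +_) (antidiagonalSum-sucʳ M (λ i j → f (suc i) j)))
        (sym (+-assoc (f 0 (suc (suc M))) _ _))

-- binomial i j is the binomial coefficient (i + j) choose i, given by Pascal's rule.
binomial : ℕ → ℕ → ℕ
binomial zero    j       = 1
binomial (suc i) zero    = 1
binomial (suc i) (suc j) = binomial i (suc j) + binomial (suc i) j

binomial-zeroʳ : ∀ i → binomial i 0 ≡ 1
binomial-zeroʳ zero    = refl
binomial-zeroʳ (suc i) = refl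

binomial-oneʳ : ∀ i → binomial i 1 ≡ suc i
binomial-oneʳ zero    = refl
binomial-oneʳ (suc i) = trans (cong (_+ 1) (binomial-oneʳ i)) (+-comm (suc i) 1)

binomial-absorption : ∀ i j → suc j * binomial i (suc j) ≡ suc (i + j) * binomial i j
binomial-absorption zero    j       = refl
binomial-absorption (suc i) zero    = begin
  binomial i 1 + 1 + 0 ≡⟨ cong (λ b → b + 1 + 0) (binomial-oneʳ i) ⟩
  suc i + 1 + 0        ≡⟨ rearrange i ⟩
  suc (suc (i + 0)) * 1 ∎
  where
  open ≡-Reasoning
  rearrange : ∀ i → suc i + 1 + 0 ≡ suc (suc (i + 0)) * 1
  rearrange = solve-∀
binomial-absorption (suc i) (suc j) = begin
  suc (suc j) * (a + (b + c))
    ≡⟨ regroupˡ (suc j) a b c ⟩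
  suc (suc j) * a + (suc j * (b + c) + (b + c))
    ≡⟨ cong₂ (λ u v → u + (v + (b + c))) (binomial-absorption i (suc j)) (binomial-absorption (suc i) j) ⟩
  suc (i + suc j) * b + (suc (suc i + j) * c + (b + c))
    ≡⟨ regroupʳ i j b c ⟩
  suc (suc i + suc j) * (b + c) ∎
  where
  open ≡-Reasoning
  a b c : ℕ
  a = binomial i (suc (suc j))
  b = binomial i (suc j)
  c = binomial (suc i) j
  regroupˡ : ∀ k a b c → suc k * (a + (b + c)) ≡ suc k * a + (k * (b + c) + (b + c))
  regroupˡ = solve-∀
  regroupʳ : ∀ i j b c → suc (i + suc j) * b + (suc (suc i + j) * c + (b + c)) ≡ suc (suc i + suc j) * (b + c)
  regroupʳ = solve-∀

shiftedˡ : (ℕ → ℕ → ℕ) → ℕ → ℕ → ℕ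
shiftedˡ f zero    j = 0
shiftedˡ f (suc i) j = f i j

shiftedʳ : (ℕ → ℕ → ℕ) → ℕ → ℕ → ℕ
shiftedʳ f i zero    = 0
shiftedʳ f i (suc j) = f i j

antidiagonalSum-shiftedʳ : ∀ M f → antidiagonalSum (suc M) (shiftedʳ f) ≡ antidiagonalSum M f
antidiagonalSum-shiftedʳ M f = trans (antidiagonalSum-sucʳ M (shiftedʳ f)) (+-identityʳ _)

binomial-theorem : ∀ x y M → (x + y) ^ M ≡ antidiagonalSum M (λ i j → binomial i j * (x ^ i * y ^ j))
binomial-theorem x y zero    = refl
binomial-theorem x y (suc M) = begin
  (x + y) * (x + y) ^ M
    ≡⟨ cong ((x + y) *_) (binomial-theorem x y M) ⟩
  (x + y) * antidiagonalSum M term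
    ≡⟨ *-distribʳ-+ _ x y ⟩
  x * antidiagonalSum M term + y * antidiagonalSum M term
    ≡⟨ cong₂ _+_ (*-distribˡ-antidiagonalSum M x term) (*-distribˡ-antidiagonalSum M y term) ⟩
  antidiagonalSum M (λ i j → x * term i j) + antidiagonalSum M (λ i j → y * term i j)
    ≡⟨ cong₂ _+_ (antidiagonalSum-cong M (λ i j _ → x*term≡termˡ i j))
                 (trans (antidiagonalSum-cong M (λ i j _ → y*term≡termʳ i j)) (sym (antidiagonalSum-shiftedʳ M termʳ))) ⟩
  antidiagonalSum (suc M) (shiftedˡ termˡ) + antidiagonalSum (suc M) (shiftedʳ termʳ)
    ≡⟨ antidiagonalSum-distrib-+ (suc M) (shiftedˡ termˡ) (shiftedʳ termʳ) ⟨
  antidiagonalSum (suc M) (λ i j → shiftedˡ termˡ i j + shiftedʳ termʳ i j)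
    ≡⟨ antidiagonalSum-cong (suc M) pascal ⟩
  antidiagonalSum (suc M) term ∎
  where
  open ≡-Reasoning
  term termˡ termʳ : ℕ → ℕ → ℕ
  term  i j = binomial i j * (x ^ i * y ^ j)
  termˡ i j = binomial i j * (x ^ suc i * y ^ j)
  termʳ i j = binomial i j * (x ^ i * y ^ suc j)
  x*term≡termˡ : ∀ i j → x * term i j ≡ termˡ i j
  x*term≡termˡ i j = rearrange x (binomial i j) (x ^ i) (y ^ j)
    where
    rearrange : ∀ x c p q → x * (c * (p * q)) ≡ c * (x * p * q)
    rearrange = solve-∀
  y*term≡termʳ : ∀ i j → y * term i j ≡ termʳ i j
  y*term≡termʳ i j = rearrange y (binomial i j) (x ^ i) (y ^ j)
    where
    rearrange : ∀ y c p q → y * (c * (p * q)) ≡ c * (p * (y * q))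
    rearrange = solve-∀
  pascal : ∀ i j → i + j ≡ suc M → shiftedˡ termˡ i j + shiftedʳ termʳ i j ≡ term i j
  pascal zero    (suc j) _ = refl
  pascal (suc i) zero    _ = trans (+-identityʳ _) (cong (_* (x ^ suc i * 1)) (binomial-zeroʳ i))
  pascal (suc i) (suc j) _ = sym (*-distribʳ-+ _ (binomial i (suc j)) (binomial (suc i) j))

-- The truncated exponential series e_M(x) = T x M / M! satisfies e_M(x + y) = ∑_{i+j=M} (xⁱ / i!) · e_j(y).
T-+ : ∀ x y M → T (x + y) M ≡ antidiagonalSum M (λ i j → binomial i j * (x ^ i * T y j))
T-+ x y zero    = refl
T-+ x y (suc M) = begin
  suc M * T (x + y) M + (x + y) ^ suc M
    ≡⟨ cong₂ _+_ (cong (suc M *_) (T-+ x y M)) (binomial-theorem x y (suc M)) ⟩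
  suc M * antidiagonalSum M term + antidiagonalSum (suc M) power
    ≡⟨ cong (_+ antidiagonalSum (suc M) power) (begin
         suc M * antidiagonalSum M term
           ≡⟨ *-distribˡ-antidiagonalSum M (suc M) term ⟩
         antidiagonalSum M (λ i j → suc M * term i j)
           ≡⟨ antidiagonalSum-cong M absorb ⟩
         antidiagonalSum M termʳ
           ≡⟨ antidiagonalSum-shiftedʳ M termʳ ⟨
         antidiagonalSum (suc M) (shiftedʳ termʳ) ∎) ⟩
  antidiagonalSum (suc M) (shiftedʳ termʳ) + antidiagonalSum (suc M) power
    ≡⟨ antidiagonalSum-distrib-+ (suc M) (shiftedʳ termʳ) power ⟨
  antidiagonalSum (suc M) (λ i j → shiftedʳ termʳ i j + power i j)
    ≡⟨ antidiagonalSum-cong (suc M) (λ i j _ → recombine i j) ⟩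
  antidiagonalSum (suc M) term ∎
  where
  open ≡-Reasoning
  term power termʳ : ℕ → ℕ → ℕ
  term  i j = binomial i j * (x ^ i * T y j)
  power i j = binomial i j * (x ^ i * y ^ j)
  termʳ i j = binomial i (suc j) * (x ^ i * (suc j * T y j))
  absorb : ∀ i j → i + j ≡ M → suc M * term i j ≡ termʳ i j
  absorb i j refl = begin
    suc (i + j) * (binomial i j * (x ^ i * T y j))
      ≡⟨ *-assoc (suc (i + j)) (binomial i j) (x ^ i * T y j) ⟨
    suc (i + j) * binomial i j * (x ^ i * T y j)
      ≡⟨ cong (_* (x ^ i * T y j)) (binomial-absorption i j) ⟨
    suc j * binomial i (suc j) * (x ^ i * T y j)
      ≡⟨ rearrange (suc j) (binomial i (suc j)) (x ^ i) (T y j) ⟩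
    termʳ i j ∎
    where
    rearrange : ∀ s c p q → s * c * (p * q) ≡ c * (p * (s * q))
    rearrange = solve-∀
  recombine : ∀ i j → shiftedʳ termʳ i j + power i j ≡ term i j
  recombine i zero    = refl
  recombine i (suc j) = factor (binomial i (suc j)) (x ^ i) (suc j * T y j) (y ^ suc j)
    where
    factor : ∀ c p u v → c * (p * u) + c * (p * v) ≡ c * (p * (u + v))
    factor = solve-∀

T-zero : ∀ j → T 0 j ≡ j !
T-zero zero    = refl
T-zero (suc j) = trans (+-identityʳ _) (cong (suc j *_) (T-zero j))

-- With eₖ = T 1 k / k! the k-th partial sum of e, the upper estimate eₖ + 1/(k·k!) of e
-- decreases in k and equals 11/4 at k = 2.
eₖ+1/[k*k!]≤11/4 : ∀ k → 4 * ((2 + k) * T 1 (2 + k) + 1) ≤ 11 * ((2 + k) * (2 + k) !)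
eₖ+1/[k*k!]≤11/4 zero    = ≤-refl
eₖ+1/[k*k!]≤11/4 (suc k) = *-cancelˡ-≤ (2 + k) (begin
  (2 + k) * (4 * ((3 + k) * T 1 (3 + k) + 1))
    ≡⟨ cong (λ p → (2 + k) * (4 * ((3 + k) * ((3 + k) * T 1 (2 + k) + p) + 1))) (^-zeroˡ (3 + k)) ⟩
  (2 + k) * (4 * ((3 + k) * ((3 + k) * T 1 (2 + k) + 1) + 1))
    ≡⟨ expand (2 + k) (T 1 (2 + k)) ⟩
  (3 + k) * (3 + k) * (4 * ((2 + k) * T 1 (2 + k))) + 4 * ((2 + k) * (4 + k))
    ≤⟨ +-monoʳ-≤ ((3 + k) * (3 + k) * (4 * ((2 + k) * T 1 (2 + k)))) (*-monoʳ-≤ 4 (n≤1+n ((2 + k) * (4 + k)))) ⟩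
  (3 + k) * (3 + k) * (4 * ((2 + k) * T 1 (2 + k))) + 4 * (1 + (2 + k) * (4 + k))
    ≡⟨ collect (2 + k) (T 1 (2 + k)) ⟩
  (3 + k) * (3 + k) * (4 * ((2 + k) * T 1 (2 + k) + 1))
    ≤⟨ *-monoʳ-≤ ((3 + k) * (3 + k)) (eₖ+1/[k*k!]≤11/4 k) ⟩
  (3 + k) * (3 + k) * (11 * ((2 + k) * (2 + k) !))
    ≡⟨ rearrange (2 + k) ((2 + k) !) ⟩
  (2 + k) * (11 * ((3 + k) * (3 + k) !)) ∎)
  where
  open ≤-Reasoning
  expand : ∀ k e → k * (4 * (suc k * (suc k * e + 1) + 1)) ≡ suc k * suc k * (4 * (k * e)) + 4 * (k * (2 + k))
  expand = solve-∀
  collect : ∀ k e → suc k * suc k * (4 * (k * e)) + 4 * (1 + k * (2 + k)) ≡ suc k * suc k * (4 * (k * e + 1))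
  collect = solve-∀
  rearrange : ∀ k f → suc k * suc k * (11 * (k * f)) ≡ k * (11 * (suc k * (suc k * f)))
  rearrange = solve-∀

eₖ≤11/4 : ∀ k → 4 * T 1 k ≤ 11 * k !
eₖ≤11/4 0 = ≤ᵇ⇒≤ 4 11 tt
eₖ≤11/4 1 = ≤ᵇ⇒≤ 8 11 tt
eₖ≤11/4 (suc (suc k)) = *-cancelˡ-≤ (2 + k) (begin
  (2 + k) * (4 * T 1 (2 + k))     ≡⟨ x∙yz≈y∙xz (2 + k) 4 (T 1 (2 + k)) ⟩
  4 * ((2 + k) * T 1 (2 + k))     ≤⟨ *-monoʳ-≤ 4 (m≤m+n ((2 + k) * T 1 (2 + k)) 1) ⟩
  4 * ((2 + k) * T 1 (2 + k) + 1) ≤⟨ eₖ+1/[k*k!]≤11/4 k ⟩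
  11 * ((2 + k) * (2 + k) !)      ≡⟨ x∙yz≈y∙xz 11 (2 + k) ((2 + k) !) ⟩
  (2 + k) * (11 * (2 + k) !)      ∎)
  where open ≤-Reasoning

4*T[x+1]≤11*T[x] : ∀ x M → 4 * T (x + 1) M ≤ 11 * T x M
4*T[x+1]≤11*T[x] x M = begin
  4 * T (x + 1) M
    ≡⟨ cong (4 *_) (T-+ x 1 M) ⟩
  4 * antidiagonalSum M (λ i j → binomial i j * (x ^ i * T 1 j))
    ≡⟨ *-distribˡ-antidiagonalSum M 4 _ ⟩
  antidiagonalSum M (λ i j → 4 * (binomial i j * (x ^ i * T 1 j)))
    ≤⟨ antidiagonalSum-mono-≤ M (λ i j _ → termwise i j) ⟩
  antidiagonalSum M (λ i j → 11 * (binomial i j * (x ^ i * T 0 j)))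
    ≡⟨ *-distribˡ-antidiagonalSum M 11 _ ⟨
  11 * antidiagonalSum M (λ i j → binomial i j * (x ^ i * T 0 j))
    ≡⟨ cong (11 *_) (T-+ x 0 M) ⟨
  11 * T (x + 0) M
    ≡⟨ cong (λ y → 11 * T y M) (+-identityʳ x) ⟩
  11 * T x M ∎
  where
  open ≤-Reasoning
  termwise : ∀ i j → 4 * (binomial i j * (x ^ i * T 1 j)) ≤ 11 * (binomial i j * (x ^ i * T 0 j))
  termwise i j = begin
    4 * (binomial i j * (x ^ i * T 1 j)) ≡⟨ rearrange 4 (binomial i j) (x ^ i) (T 1 j) ⟩
    binomial i j * x ^ i * (4 * T 1 j)   ≤⟨ *-monoʳ-≤ (binomial i j * x ^ i) (eₖ≤11/4 j) ⟩
    binomial i j * x ^ i * (11 * j !)    ≡⟨ cong (λ f → binomial i j * x ^ i * (11 * f)) (T-zero j) ⟨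
    binomial i j * x ^ i * (11 * T 0 j)  ≡⟨ rearrange 11 (binomial i j) (x ^ i) (T 0 j) ⟨
    11 * (binomial i j * (x ^ i * T 0 j)) ∎
    where
    rearrange : ∀ a c p q → a * (c * (p * q)) ≡ c * p * (a * q)
    rearrange = solve-∀

4^c*T[c]≤11^c*! : ∀ c M → 4 ^ c * T c M ≤ 11 ^ c * M !
4^c*T[c]≤11^c*! zero    M = ≤-reflexive (trans (+-identityʳ _) (trans (T-zero M) (sym (+-identityʳ _))))
4^c*T[c]≤11^c*! (suc c) M = begin
  4 * 4 ^ c * T (suc c) M    ≡⟨ cong (λ y → 4 * 4 ^ c * T y M) (+-comm 1 c) ⟩
  4 * 4 ^ c * T (c + 1) M    ≡⟨ xy∙z≈y∙xz 4 (4 ^ c) _ ⟩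
  4 ^ c * (4 * T (c + 1) M)  ≤⟨ *-monoʳ-≤ (4 ^ c) (4*T[x+1]≤11*T[x] c M) ⟩
  4 ^ c * (11 * T c M)       ≡⟨ x∙yz≈y∙xz (4 ^ c) 11 _ ⟩
  11 * (4 ^ c * T c M)       ≤⟨ *-monoʳ-≤ 11 (4^c*T[c]≤11^c*! c M) ⟩
  11 * (11 ^ c * M !)        ≡⟨ *-assoc 11 (11 ^ c) (M !) ⟨
  11 * 11 ^ c * M !          ∎
  where open ≤-Reasoning

LeExp⇒4^c*n≤11^c : ∀ {n c} → LeExp n c → 4 ^ c * n ≤ 11 ^ c
LeExp⇒4^c*n≤11^c {n} {c} (M , n*M!≤TcM) = *-cancelʳ-≤ (4 ^ c * n) (11 ^ c) (M !) {{M !≢0}} (begin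
  4 ^ c * n * M !   ≡⟨ *-assoc (4 ^ c) n (M !) ⟩
  4 ^ c * (n * M !) ≤⟨ *-monoʳ-≤ (4 ^ c) n*M!≤TcM ⟩
  4 ^ c * T c M     ≤⟨ 4^c*T[c]≤11^c*! c M ⟩
  11 ^ c * M !      ∎)
  where open ≤-Reasoning

4^[k+c]*n≤11^[k+c] : ∀ {n c} k → 4 ^ c * n ≤ 11 ^ c → 4 ^ (k + c) * n ≤ 11 ^ (k + c)
4^[k+c]*n≤11^[k+c]         zero    4^c*n≤11^c = 4^c*n≤11^c
4^[k+c]*n≤11^[k+c] {n} {c} (suc k) 4^c*n≤11^c = begin
  4 * 4 ^ (k + c) * n    ≡⟨ *-assoc 4 (4 ^ (k + c)) n ⟩
  4 * (4 ^ (k + c) * n)  ≤⟨ *-mono-≤ (≤ᵇ⇒≤ 4 11 tt) (4^[k+c]*n≤11^[k+c] k 4^c*n≤11^c) ⟩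
  11 * 11 ^ (k + c)      ∎
  where open ≤-Reasoning

[i+j]!≤[i+j]^i*j! : ∀ i j → (i + j) ! ≤ (i + j) ^ i * j !
[i+j]!≤[i+j]^i*j! zero    j = ≤-reflexive (sym (*-identityˡ _))
[i+j]!≤[i+j]^i*j! (suc i) j = begin
  suc (i + j) * (i + j) !                   ≤⟨ *-monoʳ-≤ (suc (i + j)) ([i+j]!≤[i+j]^i*j! i j) ⟩
  suc (i + j) * ((i + j) ^ i * j !)         ≤⟨ *-monoʳ-≤ (suc (i + j)) (*-monoˡ-≤ (j !) (^-monoˡ-≤ i (n≤1+n (i + j)))) ⟩
  suc (i + j) * (suc (i + j) ^ i * j !)     ≡⟨ *-assoc (suc (i + j)) (suc (i + j) ^ i) (j !) ⟨
  suc (i + j) * suc (i + j) ^ i * j !       ∎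
  where open ≤-Reasoning

-- (1 + 1/t)ᵗ ≤ eₜ ≤ 11/4, comparing the binomial expansion of (1 + t)ᵗ with tᵗ · eₜ term by term.
4*[1+t]^t≤11*t^t : ∀ t → 4 * suc t ^ t ≤ 11 * t ^ t
4*[1+t]^t≤11*t^t t = *-cancelʳ-≤ (4 * suc t ^ t) (11 * t ^ t) (t !) {{t !≢0}} (begin
  4 * suc t ^ t * t !
    ≡⟨ rearrange₁ (suc t ^ t) (t !) ⟩
  4 * (t ! * (1 + t) ^ t)
    ≡⟨ cong (λ p → 4 * (t ! * p)) (binomial-theorem 1 t t) ⟩
  4 * (t ! * antidiagonalSum t (λ i j → binomial i j * (1 ^ i * t ^ j)))
    ≡⟨ cong (4 *_) (*-distribˡ-antidiagonalSum t (t !) _) ⟩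
  4 * antidiagonalSum t (λ i j → t ! * (binomial i j * (1 ^ i * t ^ j)))
    ≤⟨ *-monoʳ-≤ 4 (antidiagonalSum-mono-≤ t termwise) ⟩
  4 * antidiagonalSum t (λ i j → t ^ t * (binomial i j * (1 ^ i * T 0 j)))
    ≡⟨ cong (4 *_) (*-distribˡ-antidiagonalSum t (t ^ t) _) ⟨
  4 * (t ^ t * antidiagonalSum t (λ i j → binomial i j * (1 ^ i * T 0 j)))
    ≡⟨ cong (λ p → 4 * (t ^ t * p)) (T-+ 1 0 t) ⟨
  4 * (t ^ t * T 1 t)
    ≡⟨ x∙yz≈y∙xz 4 (t ^ t) _ ⟩
  t ^ t * (4 * T 1 t)
    ≤⟨ *-monoʳ-≤ (t ^ t) (eₖ≤11/4 t) ⟩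
  t ^ t * (11 * t !)
    ≡⟨ rearrange₂ (t ^ t) (t !) ⟩
  11 * t ^ t * t ! ∎)
  where
  open ≤-Reasoning
  rearrange₁ : ∀ p f → 4 * p * f ≡ 4 * (f * p)
  rearrange₁ = solve-∀
  rearrange₂ : ∀ p f → p * (11 * f) ≡ 11 * p * f
  rearrange₂ = solve-∀
  termwise : ∀ i j → i + j ≡ t → t ! * (binomial i j * (1 ^ i * t ^ j)) ≤ t ^ t * (binomial i j * (1 ^ i * T 0 j))
  termwise i j refl = begin
    (i + j) ! * (binomial i j * (1 ^ i * (i + j) ^ j))
      ≡⟨ rearrange₃ ((i + j) !) (binomial i j) (1 ^ i) ((i + j) ^ j) ⟩
    binomial i j * 1 ^ i * ((i + j) ! * (i + j) ^ j)
      ≤⟨ *-monoʳ-≤ (binomial i j * 1 ^ i) (*-monoˡ-≤ ((i + j) ^ j) ([i+j]!≤[i+j]^i*j! i j)) ⟩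
    binomial i j * 1 ^ i * ((i + j) ^ i * j ! * (i + j) ^ j)
      ≡⟨ cong (binomial i j * 1 ^ i *_) (begin-equality
           (i + j) ^ i * j ! * (i + j) ^ j   ≡⟨ xy∙z≈xz∙y ((i + j) ^ i) (j !) _ ⟩
           (i + j) ^ i * (i + j) ^ j * j !   ≡⟨ cong (_* j !) (^-distribˡ-+-* (i + j) i j) ⟨
           (i + j) ^ (i + j) * j !           ≡⟨ cong ((i + j) ^ (i + j) *_) (T-zero j) ⟨
           (i + j) ^ (i + j) * T 0 j         ∎) ⟩
    binomial i j * 1 ^ i * ((i + j) ^ (i + j) * T 0 j)
      ≡⟨ rearrange₃ ((i + j) ^ (i + j)) (binomial i j) (1 ^ i) (T 0 j) ⟨
    (i + j) ^ (i + j) * (binomial i j * (1 ^ i * T 0 j)) ∎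
    where
    rearrange₃ : ∀ a c o q → a * (c * (o * q)) ≡ c * o * (a * q)
    rearrange₃ = solve-∀

^-distribʳ-* : ∀ m n k → (m * n) ^ k ≡ m ^ k * n ^ k
^-distribʳ-* m n zero    = refl
^-distribʳ-* m n (suc k) = trans (cong (m * n *_) (^-distribʳ-* m n k)) (interchange m n (m ^ k) (n ^ k))

*-^-mono-≤ : ∀ {p q x y} l → p * x ≤ q * y → p ^ l * x ^ l ≤ q ^ l * y ^ l
*-^-mono-≤ {p} {q} {x} {y} l px≤qy = begin
  p ^ l * x ^ l ≡⟨ ^-distribʳ-* p x l ⟨
  (p * x) ^ l   ≤⟨ ^-monoˡ-≤ l px≤qy ⟩
  (q * y) ^ l   ≡⟨ ^-distribʳ-* q y l ⟩
  q ^ l * y ^ l ∎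
  where open ≤-Reasoning

bernoulli : ∀ a b k → a ^ k * (a + k * b) ≤ a * (a + b) ^ k
bernoulli a b zero    = ≤-reflexive (trans (*-identityˡ (a + 0)) (trans (+-identityʳ a) (sym (*-identityʳ a))))
bernoulli a b (suc k) = begin
  a * a ^ k * (a + (b + k * b))
    ≡⟨ split a b k (a ^ k) ⟩
  a * (a ^ k * (a + k * b)) + b * (a ^ k * a)
    ≤⟨ +-monoʳ-≤ (a * (a ^ k * (a + k * b))) (*-monoʳ-≤ b (*-monoʳ-≤ (a ^ k) (m≤m+n a (k * b)))) ⟩
  a * (a ^ k * (a + k * b)) + b * (a ^ k * (a + k * b))
    ≡⟨ *-distribʳ-+ (a ^ k * (a + k * b)) a b ⟨
  (a + b) * (a ^ k * (a + k * b))
    ≤⟨ *-monoʳ-≤ (a + b) (bernoulli a b k) ⟩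
  (a + b) * (a * (a + b) ^ k)
    ≡⟨ x∙yz≈y∙xz (a + b) a _ ⟩
  a * ((a + b) * (a + b) ^ k) ∎
  where
  open ≤-Reasoning
  split : ∀ a b k p → a * p * (a + (b + k * b)) ≡ a * (p * (a + k * b)) + b * (p * a)
  split = solve-∀

-- (1 - 2/(3t))ᵗ ≤ (1 + 2/(3t))⁻ᵗ ≤ 3/5, the last step by Bernoulli's inequality.
5*[3b+1]^t≤3*[3t]^t : ∀ b → 5 * (3 * b + 1) ^ suc b ≤ 3 * (3 * suc b) ^ suc b
5*[3b+1]^t≤3*[3t]^t b = *-cancelˡ-≤ (A ^ t) {{m^n≢0 A t}} (begin
  A ^ t * (5 * B ^ t)        ≡⟨ x∙yz≈y∙xz (A ^ t) 5 (B ^ t) ⟩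
  5 * (A ^ t * B ^ t)        ≡⟨ cong (5 *_) (*-comm (A ^ t) (B ^ t)) ⟩
  5 * (B ^ t * A ^ t)        ≡⟨ x∙yz≈y∙xz 5 (B ^ t) (A ^ t) ⟩
  B ^ t * (5 * A ^ t)        ≤⟨ *-monoʳ-≤ (B ^ t) 5A^t≤3[A+2]^t ⟩
  B ^ t * (3 * (A + 2) ^ t)  ≡⟨ x∙yz≈y∙xz (B ^ t) 3 _ ⟩
  3 * (B ^ t * (A + 2) ^ t)  ≡⟨ cong (3 *_) (^-distribʳ-* B (A + 2) t) ⟨
  3 * (B * (A + 2)) ^ t      ≤⟨ *-monoʳ-≤ 3 (^-monoˡ-≤ t B[A+2]≤A*A) ⟩
  3 * (A * A) ^ t            ≡⟨ cong (3 *_) (^-distribʳ-* A A t) ⟩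
  3 * (A ^ t * A ^ t)        ≡⟨ x∙yz≈y∙xz 3 (A ^ t) (A ^ t) ⟩
  A ^ t * (3 * A ^ t)        ∎)
  where
  open ≤-Reasoning
  t A B : ℕ
  t = suc b
  A = 3 * t
  B = 3 * b + 1
  5A^t≤3[A+2]^t : 5 * A ^ t ≤ 3 * (A + 2) ^ t
  5A^t≤3[A+2]^t = *-cancelˡ-≤ t (begin
    t * (5 * A ^ t)       ≡⟨ rearrange t (A ^ t) ⟩
    A ^ t * (A + t * 2)   ≤⟨ bernoulli A 2 t ⟩
    A * (A + 2) ^ t       ≡⟨ *-assoc 3 t ((A + 2) ^ t) ⟩
    3 * (t * (A + 2) ^ t) ≡⟨ x∙yz≈y∙xz 3 t ((A + 2) ^ t) ⟩
    t * (3 * (A + 2) ^ t) ∎)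
    where
    rearrange : ∀ t p → t * (5 * p) ≡ p * (3 * t + t * 2)
    rearrange = solve-∀
  B[A+2]≤A*A : B * (A + 2) ≤ A * A
  B[A+2]≤A*A = ≤-trans (m≤m+n (B * (A + 2)) 4) (≤-reflexive (difference-of-squares b))
    where
    difference-of-squares : ∀ b → (3 * b + 1) * (3 * suc b + 2) + 4 ≡ 3 * suc b * (3 * suc b)
    difference-of-squares = solve-∀

-- Binomial tail bounds

-- completions b f r s = ∑ₖ (r choose k) · b ^ (r - k) · f (s + k): the total of f over the final
-- sizes of a part that has s colours, when r more colours each go into it or into one of b other parts.
completions : ℕ → (ℕ → ℕ) → ℕ → ℕ → ℕ
completions b f zero    s = f s
completions b f (suc r) s = completions b f r (suc s) + b * completions b f r s

completions-distrib-+ : ∀ b f g r s →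
  completions b (λ s → f s + g s) r s ≡ completions b f r s + completions b g r s
completions-distrib-+ b f g zero    s = refl
completions-distrib-+ b f g (suc r) s = begin
  completions b (λ s → f s + g s) r (suc s) + b * completions b (λ s → f s + g s) r s
    ≡⟨ cong₂ (λ u v → u + b * v) (completions-distrib-+ b f g r (suc s)) (completions-distrib-+ b f g r s) ⟩
  (F₁ + G₁) + b * (F₀ + G₀)
    ≡⟨ regroup b F₁ G₁ F₀ G₀ ⟩
  (F₁ + b * F₀) + (G₁ + b * G₀) ∎
  where
  open ≡-Reasoning
  F₁ G₁ F₀ G₀ : ℕ
  F₁ = completions b f r (suc s)
  G₁ = completions b g r (suc s)
  F₀ = completions b f r s
  G₀ = completions b g r s
  regroup : ∀ b p q u v → (p + q) + b * (u + v) ≡ (p + b * u) + (q + b * v)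
  regroup = solve-∀

-- Markov's inequality for xᵏ (upper tail) and for x⁻ᵏ (lower tail), with denominators cleared.
completions-upper : ∀ b {f} d x → (∀ s → d * f s ≤ x ^ s) →
                    ∀ r s → d * completions b f r s ≤ x ^ s * (x + b) ^ r
completions-upper b d x d*f≤xˢ zero    s = ≤-trans (d*f≤xˢ s) (≤-reflexive (sym (*-identityʳ (x ^ s))))
completions-upper b {f} d x d*f≤xˢ (suc r) s = begin
  d * (completions b f r (suc s) + b * completions b f r s)
    ≡⟨ *-distribˡ-+ d _ _ ⟩
  d * completions b f r (suc s) + d * (b * completions b f r s)
    ≡⟨ cong (d * completions b f r (suc s) +_) (x∙yz≈y∙xz d b _) ⟩
  d * completions b f r (suc s) + b * (d * completions b f r s)
    ≤⟨ +-mono-≤ (completions-upper b d x d*f≤xˢ r (suc s)) (*-monoʳ-≤ b (completions-upper b d x d*f≤xˢ r s)) ⟩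
  x * x ^ s * (x + b) ^ r + b * (x ^ s * (x + b) ^ r)
    ≡⟨ regroup x b (x ^ s) ((x + b) ^ r) ⟩
  x ^ s * ((x + b) * (x + b) ^ r) ∎
  where
  open ≤-Reasoning
  regroup : ∀ x b p q → x * p * q + b * (p * q) ≡ p * ((x + b) * q)
  regroup = solve-∀

completions-lower : ∀ b {f} e x → (∀ s → x ^ s * f s ≤ e) →
                    ∀ r s → x ^ (s + r) * completions b f r s ≤ e * (x * b + 1) ^ r
completions-lower b {f} e x xˢ*f≤e zero    s = begin
  x ^ (s + 0) * f s ≡⟨ cong (λ k → x ^ k * f s) (+-identityʳ s) ⟩
  x ^ s * f s       ≤⟨ xˢ*f≤e s ⟩
  e                 ≡⟨ *-identityʳ e ⟨
  e * 1             ∎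
  where open ≤-Reasoning
completions-lower b {f} e x xˢ*f≤e (suc r) s = begin
  x ^ (s + suc r) * (completions b f r (suc s) + b * completions b f r s)
    ≡⟨ cong (λ k → x ^ k * (completions b f r (suc s) + b * completions b f r s)) (+-suc s r) ⟩
  x * x ^ (s + r) * (completions b f r (suc s) + b * completions b f r s)
    ≡⟨ regroup x b (x ^ (s + r)) _ _ ⟩
  x ^ (suc s + r) * completions b f r (suc s) + x * b * (x ^ (s + r) * completions b f r s)
    ≤⟨ +-mono-≤ (completions-lower b e x xˢ*f≤e r (suc s)) (*-monoʳ-≤ (x * b) (completions-lower b e x xˢ*f≤e r s)) ⟩
  e * (x * b + 1) ^ r + x * b * (e * (x * b + 1) ^ r)
    ≡⟨ collect e (x * b) ((x * b + 1) ^ r) ⟩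
  e * ((x * b + 1) * (x * b + 1) ^ r) ∎
  where
  open ≤-Reasoning
  regroup : ∀ x b p u v → x * p * (u + b * v) ≡ x * p * u + x * b * (p * v)
  regroup = solve-∀
  collect : ∀ e y q → e * q + y * (e * q) ≡ e * ((y + 1) * q)
  collect = solve-∀

below : ℕ → ℕ → ℕ
below lo s with s <? lo
... | yes _ = 1
... | no  _ = 0

above : ℕ → ℕ → ℕ
above hi s with hi <? s
... | yes _ = 1
... | no  _ = 0

outside : ℕ → ℕ → ℕ → ℕ
outside lo hi s = below lo s + above hi s

outside≡0⇒lo≤s≤hi : ∀ lo hi s → outside lo hi s ≡ 0 → lo ≤ s × s ≤ hi
outside≡0⇒lo≤s≤hi lo hi s outside≡0 with s <? lo | hi <? s | outside≡0
... | no s≮lo | no hi≮s | _  = ≮⇒≥ s≮lo , ≮⇒≥ hi≮s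
... | yes _   | _       | ()
... | no _    | yes _   | ()

upper-tail : ∀ b hi r → 2 ^ suc hi * completions b (above hi) r 0 ≤ (2 + b) ^ r
upper-tail b hi r = ≤-trans (completions-upper b (2 ^ suc hi) 2 2^[1+hi]*above≤2ˢ r 0) (≤-reflexive (+-identityʳ _))
  where
  2^[1+hi]*above≤2ˢ : ∀ s → 2 ^ suc hi * above hi s ≤ 2 ^ s
  2^[1+hi]*above≤2ˢ s with hi <? s
  ... | yes hi<s = ≤-trans (≤-reflexive (*-identityʳ _)) (^-monoʳ-≤ 2 hi<s)
  ... | no  _    = ≤-trans (≤-reflexive (*-zeroʳ (2 ^ suc hi))) z≤n

lower-tail : ∀ b lo r → 3 ^ r * completions b (below (suc lo)) r 0 ≤ 3 ^ lo * (3 * b + 1) ^ r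
lower-tail b lo r = completions-lower b (3 ^ lo) 3 3ˢ*below≤3^lo r 0
  where
  3ˢ*below≤3^lo : ∀ s → 3 ^ s * below (suc lo) s ≤ 3 ^ lo
  3ˢ*below≤3^lo s with s <? suc lo
  ... | yes s<1+lo = ≤-trans (≤-reflexive (*-identityʳ _)) (^-monoʳ-≤ 3 (m<1+n⇒m≤n s<1+lo))
  ... | no  _      = ≤-trans (≤-reflexive (*-zeroʳ (3 ^ s))) z≤n

-- The method of conditional expectations

∑-const : ∀ n c → ∑[ i < n ] c ≡ n * c
∑-const zero    c = refl
∑-const (suc n) c = cong (c +_) (∑-const n c)

∑-indicator : ∀ b (i : Fin (suc b)) (g : Bool → ℕ) → ∑[ j < suc b ] g (does (j ≟ᶠ i)) ≡ g true + b * g false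
∑-indicator zero    zero    g = refl
∑-indicator (suc b) zero    g = cong (g true +_) (∑-const (suc b) (g false))
∑-indicator (suc b) (suc i) g = trans (cong (g false +_) (∑-indicator b i g)) (x+[y+z]≡y+[x+z] (g false) (g true) _)

m*n<m⇒n≡0 : ∀ {m n} → m * n < m → n ≡ 0
m*n<m⇒n≡0 {m} {zero}  _     = refl
m*n<m⇒n≡0 {m} {suc n} m*n<m = contradiction (m≤m*n m (suc n)) (<⇒≱ m*n<m)

term≤∑ : ∀ {n} (g : Fin n → ℕ) v → g v ≤ ∑[ u < n ] g u
term≤∑ g zero    = m≤m+n (g zero) _
term≤∑ g (suc v) = ≤-trans (term≤∑ (g ∘ suc) v) (m≤n+m _ (g zero))

∃-term≤mean : ∀ {k} (g : Fin (suc k) → ℕ) → ∃[ j ] (suc k * g j ≤ ∑[ u < suc k ] g u)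
∃-term≤mean {zero}  g = zero , ≤-refl
∃-term≤mean {suc k} g with ∃-term≤mean (g ∘ suc)
... | j , mean-tail with g zero ≤? g (suc j)
...   | yes g₀≤gⱼ = zero , +-monoʳ-≤ (g zero) (≤-trans (*-monoʳ-≤ (suc k) g₀≤gⱼ) mean-tail)
...   | no  g₀≰gⱼ = suc j , +-mono-≤ (<⇒≤ (≰⇒> g₀≰gⱼ)) mean-tail

_[_≔_] : ∀ {A : Set} → (ℕ → A) → ℕ → A → ℕ → A
(g [ x ≔ a ]) c = if does (c ≟ x) then a else g c

[≔]-same : ∀ {A : Set} (g : ℕ → A) x a → (g [ x ≔ a ]) x ≡ a
[≔]-same g x a = cong (λ d → if d then a else g x) (dec-true (x ≟ x) refl)

[≔]-other : ∀ {A : Set} (g : ℕ → A) {x c} a → c ≢ x → (g [ x ≔ a ]) c ≡ g c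
[≔]-other g {x} {c} a c≢x = cong (λ d → if d then a else g c) (dec-false (c ≟ x) c≢x)

undecidedOn : ∀ {t} → List ℕ → (ℕ → Fin t) → ℕ → Maybe (Fin t)
undecidedOn []      part = just ∘ part
undecidedOn (x ∷ R) part = undecidedOn R part [ x ≔ nothing ]

undecidedOn-∈ : ∀ {t} R (part : ℕ → Fin t) {c} → c ∈ R → undecidedOn R part c ≡ nothing
undecidedOn-∈ (x ∷ R) part (here refl) = [≔]-same (undecidedOn R part) x nothing
undecidedOn-∈ (x ∷ R) part {c} (there c∈R) with c ≟ x
... | yes refl = [≔]-same (undecidedOn R part) x nothing
... | no  c≢x  = trans ([≔]-other (undecidedOn R part) nothing c≢x) (undecidedOn-∈ R part c∈R)

undecidedOn-[≔] : ∀ {t} R (part : ℕ → Fin t) x j → All (x ≢_) R →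
                  ∀ c → undecidedOn R (part [ x ≔ j ]) c ≡ (undecidedOn R part [ x ≔ just j ]) c
undecidedOn-[≔] [] part x j _ c with c ≟ x
... | yes refl = trans (cong just ([≔]-same part c j)) (sym ([≔]-same (just ∘ part) c (just j)))
... | no  c≢x  = trans (cong just ([≔]-other part j c≢x)) (sym ([≔]-other (just ∘ part) (just j) c≢x))
undecidedOn-[≔] (y ∷ R) part x j (x≢y ∷ x∉R) c with c ≟ y
... | yes refl = begin
  (undecidedOn R (part [ x ≔ j ]) [ c ≔ nothing ]) c     ≡⟨ [≔]-same (undecidedOn R (part [ x ≔ j ])) c nothing ⟩
  nothing                                               ≡⟨ [≔]-same (undecidedOn R part) c nothing ⟨
  (undecidedOn R part [ c ≔ nothing ]) c                ≡⟨ [≔]-other (undecidedOn R part [ c ≔ nothing ]) (just j) (≢-sym x≢y) ⟨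
  (undecidedOn R part [ c ≔ nothing ] [ x ≔ just j ]) c ∎
  where open ≡-Reasoning
... | no  c≢y  with c ≟ x
...   | yes refl = begin
  (undecidedOn R (part [ c ≔ j ]) [ y ≔ nothing ]) c    ≡⟨ [≔]-other (undecidedOn R (part [ c ≔ j ])) nothing c≢y ⟩
  undecidedOn R (part [ c ≔ j ]) c                      ≡⟨ undecidedOn-[≔] R part c j x∉R c ⟩
  (undecidedOn R part [ c ≔ just j ]) c                 ≡⟨ [≔]-same (undecidedOn R part) c (just j) ⟩
  just j                                                ≡⟨ [≔]-same (undecidedOn R part [ y ≔ nothing ]) c (just j) ⟨
  (undecidedOn R part [ y ≔ nothing ] [ c ≔ just j ]) c ∎
  where open ≡-Reasoning
...   | no  c≢x  = begin
  (undecidedOn R (part [ x ≔ j ]) [ y ≔ nothing ]) c    ≡⟨ [≔]-other (undecidedOn R (part [ x ≔ j ])) nothing c≢y ⟩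
  undecidedOn R (part [ x ≔ j ]) c                      ≡⟨ undecidedOn-[≔] R part x j x∉R c ⟩
  (undecidedOn R part [ x ≔ just j ]) c                 ≡⟨ [≔]-other (undecidedOn R part) (just j) c≢x ⟩
  undecidedOn R part c                                  ≡⟨ [≔]-other (undecidedOn R part) nothing c≢y ⟨
  (undecidedOn R part [ y ≔ nothing ]) c                ≡⟨ [≔]-other (undecidedOn R part [ y ≔ nothing ]) (just j) c≢x ⟨
  (undecidedOn R part [ y ≔ nothing ] [ x ≔ just j ]) c ∎
  where open ≡-Reasoning

module Potential {b : ℕ} (f : ℕ → ℕ) where

  -- Deciding a colour multiplies by t = suc b, so that every potential is normalised to t ^ length ℓ.
  colourStep : Maybe (Fin (suc b)) → Fin (suc b) → (ℕ → ℕ) → ℕ → ℕ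
  colourStep nothing  i h s = h (suc s) + b * h s
  colourStep (just j) i h s = suc b * h (if does (j ≟ᶠ i) then suc s else s)

  -- potential σ i ℓ s is t ^ length ℓ times the expected value of f (s + |ℓ ∩ Pⁱ|) when every colour
  -- of ℓ left undecided by σ is put into a uniformly random part.
  potential : (ℕ → Maybe (Fin (suc b))) → Fin (suc b) → List ℕ → ℕ → ℕ
  potential σ i []       = f
  potential σ i (y ∷ ys) = colourStep (σ y) i (potential σ i ys)

  colourStep-cong : ∀ d i {h h′} → (∀ s → h s ≡ h′ s) → ∀ s → colourStep d i h s ≡ colourStep d i h′ s
  colourStep-cong nothing  i h≗h′ s = cong₂ (λ u v → u + b * v) (h≗h′ (suc s)) (h≗h′ s)
  colourStep-cong (just j) i h≗h′ s = cong (suc b *_) (h≗h′ _)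

  potential-cong : ∀ {σ τ} i {ℓ} → All (λ c → σ c ≡ τ c) ℓ → ∀ s → potential σ i ℓ s ≡ potential τ i ℓ s
  potential-cong         i {[]}     []             s = refl
  potential-cong {σ} {τ} i {y ∷ ys} (σy≡τy ∷ σ≗τ) s =
    trans (cong (λ d → colourStep d i (potential σ i ys) s) σy≡τy) (colourStep-cong (τ y) i (potential-cong i σ≗τ) s)

  potential-undecided : ∀ {σ} i {ℓ} → All (λ c → σ c ≡ nothing) ℓ → ∀ s → potential σ i ℓ s ≡ completions b f (length ℓ) s
  potential-undecided     i {[]}     []                  s = refl
  potential-undecided {σ} i {y ∷ ys} (σy≡nothing ∷ rest) s =
    trans (cong (λ d → colourStep d i (potential σ i ys) s) σy≡nothing)
          (cong₂ (λ u v → u + b * v) (potential-undecided i rest (suc s)) (potential-undecided i rest s))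

  potential-decided : ∀ part i ℓ s → potential (just ∘ part) i ℓ s ≡ suc b ^ length ℓ * f (s + partSize part i ℓ)
  potential-decided part i []       s = sym (trans (*-identityˡ _) (cong f (+-identityʳ s)))
  potential-decided part i (y ∷ ys) s with part y ≟ᶠ i
  ... | yes _ = trans (cong (suc b *_) (potential-decided part i ys (suc s)))
                      (trans (sym (*-assoc (suc b) (suc b ^ length ys) _))
                             (cong (λ k → suc b ^ suc (length ys) * f k) (sym (+-suc s (partSize part i ys)))))
  ... | no  _ = trans (cong (suc b *_) (potential-decided part i ys s))
                      (sym (*-assoc (suc b) (suc b ^ length ys) (f (s + partSize part i ys))))

  ∑-colourStep-linear : ∀ d i (h : Fin (suc b) → ℕ → ℕ) g → (∀ s → ∑[ j < suc b ] h j s ≡ suc b * g s) →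
                        ∀ s → ∑[ j < suc b ] colourStep d i (h j) s ≡ suc b * colourStep d i g s
  ∑-colourStep-linear nothing i h g ∑h≡t*g s = begin
    ∑[ j < suc b ] (h j (suc s) + b * h j s)
      ≡⟨ ∑-distrib-+ (λ j → h j (suc s)) (λ j → b * h j s) ⟩
    ∑[ j < suc b ] h j (suc s) + ∑[ j < suc b ] (b * h j s)
      ≡⟨ cong (∑[ j < suc b ] h j (suc s) +_) (*-distribˡ-sum b (λ j → h j s)) ⟨
    ∑[ j < suc b ] h j (suc s) + b * ∑[ j < suc b ] h j s
      ≡⟨ cong₂ (λ u v → u + b * v) (∑h≡t*g (suc s)) (∑h≡t*g s) ⟩
    suc b * g (suc s) + b * (suc b * g s)
      ≡⟨ cong (suc b * g (suc s) +_) (x∙yz≈y∙xz b (suc b) (g s)) ⟩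
    suc b * g (suc s) + suc b * (b * g s)
      ≡⟨ *-distribˡ-+ (suc b) (g (suc s)) (b * g s) ⟨
    suc b * (g (suc s) + b * g s) ∎
    where open ≡-Reasoning
  ∑-colourStep-linear (just k) i h g ∑h≡t*g s =
    trans (sym (*-distribˡ-sum (suc b) (λ j → h j s′))) (cong (suc b *_) (∑h≡t*g s′))
    where
    s′ : ℕ
    s′ = if does (k ≟ᶠ i) then suc s else s

  ∑-colourStep-just : ∀ i h s → ∑[ j < suc b ] colourStep (just j) i h s ≡ suc b * colourStep nothing i h s
  ∑-colourStep-just i h s =
    trans (sym (*-distribˡ-sum (suc b) (λ j → h (if does (j ≟ᶠ i) then suc s else s))))
          (cong (suc b *_) (∑-indicator b i (λ c → h (if c then suc s else s))))

  potential-split : ∀ σ x i ℓ → Unique ℓ → ∀ s →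
    ∑[ j < suc b ] potential (σ [ x ≔ just j ]) i ℓ s ≡ suc b * potential (σ [ x ≔ nothing ]) i ℓ s
  potential-split σ x i []       []                 s = ∑-const (suc b) (f s)
  potential-split σ x i (y ∷ ys) (y∉ys ∷ ys-unique) s with y ≟ x
  ... | no y≢x = begin
    ∑[ j < suc b ] colourStep ((σ [ x ≔ just j ]) y) i (potential (σ [ x ≔ just j ]) i ys) s
      ≡⟨ sum-cong-≗ (λ j → cong (λ d → colourStep d i (potential (σ [ x ≔ just j ]) i ys) s) ([≔]-other σ (just j) y≢x)) ⟩
    ∑[ j < suc b ] colourStep (σ y) i (potential (σ [ x ≔ just j ]) i ys) s
      ≡⟨ ∑-colourStep-linear (σ y) i (λ j → potential (σ [ x ≔ just j ]) i ys) (potential (σ [ x ≔ nothing ]) i ys)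
                             (potential-split σ x i ys ys-unique) s ⟩
    suc b * colourStep (σ y) i (potential (σ [ x ≔ nothing ]) i ys) s
      ≡⟨ cong (λ d → suc b * colourStep d i (potential (σ [ x ≔ nothing ]) i ys) s) ([≔]-other σ nothing y≢x) ⟨
    suc b * colourStep ((σ [ x ≔ nothing ]) y) i (potential (σ [ x ≔ nothing ]) i ys) s ∎
    where open ≡-Reasoning
  ... | yes refl = begin
    ∑[ j < suc b ] colourStep ((σ [ y ≔ just j ]) y) i (potential (σ [ y ≔ just j ]) i ys) s
      ≡⟨ sum-cong-≗ (λ j → trans (cong (λ d → colourStep d i (potential (σ [ y ≔ just j ]) i ys) s) ([≔]-same σ y (just j)))
                                 (colourStep-cong (just j) i (λ s → trans (unaffected (just j) s) (sym (unaffected nothing s))) s)) ⟩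
    ∑[ j < suc b ] colourStep (just j) i (potential (σ [ y ≔ nothing ]) i ys) s
      ≡⟨ ∑-colourStep-just i (potential (σ [ y ≔ nothing ]) i ys) s ⟩
    suc b * colourStep nothing i (potential (σ [ y ≔ nothing ]) i ys) s
      ≡⟨ cong (λ d → suc b * colourStep d i (potential (σ [ y ≔ nothing ]) i ys) s) ([≔]-same σ y nothing) ⟨
    suc b * colourStep ((σ [ y ≔ nothing ]) y) i (potential (σ [ y ≔ nothing ]) i ys) s ∎
    where
    open ≡-Reasoning
    unaffected : ∀ a s → potential (σ [ y ≔ a ]) i ys s ≡ potential σ i ys s
    unaffected a = potential-cong i (All.map (λ y≢c → [≔]-other σ a (≢-sym y≢c)) y∉ys)

  module _ {n} (L : Fin n → List ℕ) (i : Fin n → Fin (suc b)) (L-unique : ∀ v → Unique (L v)) where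

    Φ : (ℕ → Maybe (Fin (suc b))) → ℕ
    Φ σ = ∑[ v < n ] potential σ (i v) (L v) 0

    Φ-cong : ∀ {σ τ} → (∀ c → σ c ≡ τ c) → Φ σ ≡ Φ τ
    Φ-cong σ≗τ = sum-cong-≗ (λ v → potential-cong (i v) {L v} (All.tabulate (λ {c} _ → σ≗τ c)) 0)

    Φ-split : ∀ σ x → ∑[ j < suc b ] Φ (σ [ x ≔ just j ]) ≡ suc b * Φ (σ [ x ≔ nothing ])
    Φ-split σ x = begin
      ∑[ j < suc b ] ∑[ v < n ] potential (σ [ x ≔ just j ]) (i v) (L v) 0
        ≡⟨ ∑-comm (λ j v → potential (σ [ x ≔ just j ]) (i v) (L v) 0) ⟩
      ∑[ v < n ] ∑[ j < suc b ] potential (σ [ x ≔ just j ]) (i v) (L v) 0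
        ≡⟨ sum-cong-≗ (λ v → potential-split σ x (i v) (L v) (L-unique v) 0) ⟩
      ∑[ v < n ] (suc b * potential (σ [ x ≔ nothing ]) (i v) (L v) 0)
        ≡⟨ *-distribˡ-sum (suc b) (λ v → potential (σ [ x ≔ nothing ]) (i v) (L v) 0) ⟨
      suc b * Φ (σ [ x ≔ nothing ]) ∎
      where open ≡-Reasoning

    descend : ∀ R → Unique R → ∀ part → ∃[ part′ ] (Φ (just ∘ part′) ≤ Φ (undecidedOn R part))
    descend []      _                part = part , ≤-refl
    descend (x ∷ R) (x∉R ∷ R-unique) part with ∃-term≤mean (λ j → Φ (undecidedOn R part [ x ≔ just j ]))
    ... | j , t*Φⱼ≤∑Φ with descend R R-unique (part [ x ≔ j ])
    ...   | part′ , Φ′≤Φⱼ = part′ , (begin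
      Φ (just ∘ part′)                      ≤⟨ Φ′≤Φⱼ ⟩
      Φ (undecidedOn R (part [ x ≔ j ]))    ≡⟨ Φ-cong (undecidedOn-[≔] R part x j x∉R) ⟩
      Φ (undecidedOn R part [ x ≔ just j ]) ≤⟨ *-cancelˡ-≤ (suc b) (≤-trans t*Φⱼ≤∑Φ (≤-reflexive (Φ-split (undecidedOn R part) x))) ⟩
      Φ (undecidedOn (x ∷ R) part)          ∎)
      where open ≤-Reasoning

    ∃-zero-weight-partition : ∀ N → (∀ v → length (L v) ≡ N) → n * completions b f N 0 < suc b ^ N →
                              ∃[ part ] ∀ v → f (partSize part (i v) (L v)) ≡ 0
    ∃-zero-weight-partition N L-length Φ₀<tᴺ = part , λ v → m*n<m⇒n≡0 (begin-strict
      suc b ^ N * f (partSize part (i v) (L v))      ≡⟨ final-potential v ⟨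
      potential (just ∘ part) (i v) (L v) 0          ≤⟨ term≤∑ (λ u → potential (just ∘ part) (i u) (L u) 0) v ⟩
      Φ (just ∘ part)                                ≤⟨ proj₂ descent ⟩
      Φ (undecidedOn palette (λ _ → zero))           ≡⟨ initial-potential ⟩
      n * completions b f N 0                        <⟨ Φ₀<tᴺ ⟩
      suc b ^ N                                      ∎)
      where
      open ≤-Reasoning
      palette : List ℕ
      palette = deduplicate _≟_ (concat (tabulate L))
      ⊆palette : ∀ v {c} → c ∈ L v → c ∈ palette
      ⊆palette v c∈Lv = ∈-deduplicate⁺ _≟_ (∈-concat⁺′ c∈Lv (∈-tabulate⁺ v))
      descent : ∃[ part ] (Φ (just ∘ part) ≤ Φ (undecidedOn palette (λ _ → zero)))
      descent = descend palette (deduplicate-! _) (λ _ → zero)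
      part : ℕ → Fin (suc b)
      part = proj₁ descent
      initial-potential : Φ (undecidedOn palette (λ _ → zero)) ≡ n * completions b f N 0
      initial-potential = trans
        (sum-cong-≗ (λ v → trans (potential-undecided (i v) (All.tabulate (λ c∈Lv → undecidedOn-∈ palette _ (⊆palette v c∈Lv))) 0)
                                 (cong (λ r → completions b f r 0) (L-length v))))
        (∑-const n (completions b f N 0))
      final-potential : ∀ v → potential (just ∘ part) (i v) (L v) 0 ≡ suc b ^ N * f (partSize part (i v) (L v))
      final-potential v = trans (potential-decided part (i v) (L v) 0)
                                (cong (λ k → suc b ^ k * f (partSize part (i v) (L v))) (L-length v))

-- With t = b + 1, m = z + c and N = 5tm: each tail of |L_v ∩ P^{i_v}| has probability below 1/(2n),
-- stated after multiplying by tᴺ; the only information on n is n ≤ (11/4)ᵐ.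
module Tails (b m₀ n : ℕ) (4^m*n≤11^m : 4 ^ suc m₀ * n ≤ 11 ^ suc m₀) where

  t m N : ℕ
  t = suc b
  m = suc m₀
  N = 5 * t * m

  ^N≡[^5t]^m : ∀ x → x ^ N ≡ (x ^ (5 * t)) ^ m
  ^N≡[^5t]^m x = sym (^-*-assoc x (5 * t) m)

  ^[5*k]≡[^k]^5 : ∀ x k → x ^ (5 * k) ≡ (x ^ k) ^ 5
  ^[5*k]≡[^k]^5 x k = trans (cong (x ^_) (*-comm 5 k)) (sym (^-*-assoc x k 5))

  [2^9]^m*2*upper≤[[t+1]^5t]^m : (2 ^ 9) ^ m * (2 * completions b (above (9 * m)) N 0) ≤ ((2 + b) ^ (5 * t)) ^ m
  [2^9]^m*2*upper≤[[t+1]^5t]^m = begin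
    (2 ^ 9) ^ m * (2 * U)   ≡⟨ cong (_* (2 * U)) (^-*-assoc 2 9 m) ⟩
    2 ^ (9 * m) * (2 * U)   ≡⟨ x∙yz≈y∙xz (2 ^ (9 * m)) 2 U ⟩
    2 * (2 ^ (9 * m) * U)   ≡⟨ *-assoc 2 (2 ^ (9 * m)) U ⟨
    2 ^ suc (9 * m) * U     ≤⟨ upper-tail b (9 * m) N ⟩
    (2 + b) ^ N             ≡⟨ ^N≡[^5t]^m (2 + b) ⟩
    ((2 + b) ^ (5 * t)) ^ m ∎
    where
    open ≤-Reasoning
    U : ℕ
    U = completions b (above (9 * m)) N 0

  3^N*3*lower≤3^m*[[3b+1]^5t]^m : 3 ^ N * (3 * completions b (below m) N 0) ≤ 3 ^ m * ((3 * b + 1) ^ (5 * t)) ^ m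
  3^N*3*lower≤3^m*[[3b+1]^5t]^m = begin
    3 ^ N * (3 * L)                       ≡⟨ x∙yz≈y∙xz (3 ^ N) 3 L ⟩
    3 * (3 ^ N * L)                       ≤⟨ *-monoʳ-≤ 3 (lower-tail b m₀ N) ⟩
    3 * (3 ^ m₀ * (3 * b + 1) ^ N)        ≡⟨ *-assoc 3 (3 ^ m₀) _ ⟨
    3 ^ m * (3 * b + 1) ^ N               ≡⟨ cong (3 ^ m *_) (^N≡[^5t]^m (3 * b + 1)) ⟩
    3 ^ m * ((3 * b + 1) ^ (5 * t)) ^ m   ∎
    where
    open ≤-Reasoning
    L : ℕ
    L = completions b (below m) N 0

  4^5*[t+1]^5t≤11^5*t^5t : 4 ^ 5 * (2 + b) ^ (5 * t) ≤ 11 ^ 5 * t ^ (5 * t)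
  4^5*[t+1]^5t≤11^5*t^5t = begin
    4 ^ 5 * (2 + b) ^ (5 * t)    ≡⟨ cong (4 ^ 5 *_) (^[5*k]≡[^k]^5 (2 + b) t) ⟩
    4 ^ 5 * ((2 + b) ^ t) ^ 5    ≤⟨ *-^-mono-≤ {4} {11} {(2 + b) ^ t} {t ^ t} 5 (4*[1+t]^t≤11*t^t t) ⟩
    11 ^ 5 * (t ^ t) ^ 5         ≡⟨ cong (11 ^ 5 *_) (^[5*k]≡[^k]^5 t t) ⟨
    11 ^ 5 * t ^ (5 * t)         ∎
    where open ≤-Reasoning

  5^5*[3b+1]^5t≤3^5*[3t]^5t : 5 ^ 5 * (3 * b + 1) ^ (5 * t) ≤ 3 ^ 5 * (3 * t) ^ (5 * t)
  5^5*[3b+1]^5t≤3^5*[3t]^5t = begin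
    5 ^ 5 * (3 * b + 1) ^ (5 * t)    ≡⟨ cong (5 ^ 5 *_) (^[5*k]≡[^k]^5 (3 * b + 1) t) ⟩
    5 ^ 5 * ((3 * b + 1) ^ t) ^ 5    ≤⟨ *-^-mono-≤ {5} {3} {(3 * b + 1) ^ t} {(3 * t) ^ t} 5 (5*[3b+1]^t≤3*[3t]^t b) ⟩
    3 ^ 5 * ((3 * t) ^ t) ^ 5        ≡⟨ cong (3 ^ 5 *_) (^[5*k]≡[^k]^5 (3 * t) t) ⟨
    3 ^ 5 * (3 * t) ^ (5 * t)        ∎
    where open ≤-Reasoning

  upper-tail-rare : 2 * n * completions b (above (9 * m)) N 0 ≤ t ^ N
  upper-tail-rare = *-cancelˡ-≤ K {{m^n≢0 (4 * 4 ^ 5 * 2 ^ 9) m}} (begin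
    K * (2 * n * U)
      ≡⟨ cong (_* (2 * n * U)) (trans (^-distribʳ-* (4 * 4 ^ 5) (2 ^ 9) m) (cong (_* (2 ^ 9) ^ m) (^-distribʳ-* 4 (4 ^ 5) m))) ⟩
    4 ^ m * (4 ^ 5) ^ m * (2 ^ 9) ^ m * (2 * n * U)
      ≡⟨ regroup (4 ^ m) ((4 ^ 5) ^ m) ((2 ^ 9) ^ m) n U ⟩
    4 ^ m * n * ((4 ^ 5) ^ m * ((2 ^ 9) ^ m * (2 * U)))
      ≤⟨ *-mono-≤ 4^m*n≤11^m (*-monoʳ-≤ ((4 ^ 5) ^ m) [2^9]^m*2*upper≤[[t+1]^5t]^m) ⟩
    11 ^ m * ((4 ^ 5) ^ m * ((2 + b) ^ (5 * t)) ^ m)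
      ≤⟨ *-monoʳ-≤ (11 ^ m) (*-^-mono-≤ {4 ^ 5} {11 ^ 5} {(2 + b) ^ (5 * t)} {t ^ (5 * t)} m 4^5*[t+1]^5t≤11^5*t^5t) ⟩
    11 ^ m * ((11 ^ 5) ^ m * (t ^ (5 * t)) ^ m)
      ≡⟨ *-assoc (11 ^ m) ((11 ^ 5) ^ m) _ ⟨
    11 ^ m * (11 ^ 5) ^ m * (t ^ (5 * t)) ^ m
      ≡⟨ cong₂ _*_ (^-distribʳ-* 11 (11 ^ 5) m) (^N≡[^5t]^m t) ⟨
    (11 * 11 ^ 5) ^ m * t ^ N
      ≤⟨ *-monoˡ-≤ (t ^ N) (^-monoˡ-≤ m (≤ᵇ⇒≤ (11 * 11 ^ 5) (4 * 4 ^ 5 * 2 ^ 9) tt)) ⟩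
    K * t ^ N ∎)
    where
    open ≤-Reasoning
    K U : ℕ
    K = (4 * 4 ^ 5 * 2 ^ 9) ^ m
    U = completions b (above (9 * m)) N 0
    regroup : ∀ a c d n u → a * c * d * (2 * n * u) ≡ a * n * (c * (d * (2 * u)))
    regroup = solve-∀

  lower-tail-rare : 2 * n * completions b (below m) N 0 < t ^ N
  lower-tail-rare = *-cancelˡ-< K (2 * n * L) (t ^ N) (begin-strict
    K * (2 * n * L)
      ≡⟨ regroup₁ (4 ^ m) ((5 ^ 5) ^ m) (3 ^ N) n L ⟩
    2 * (4 ^ m * n) * ((5 ^ 5) ^ m * (3 ^ N * (3 * L)))
      ≤⟨ *-mono-≤ (*-monoʳ-≤ 2 4^m*n≤11^m) (*-monoʳ-≤ ((5 ^ 5) ^ m) 3^N*3*lower≤3^m*[[3b+1]^5t]^m) ⟩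
    2 * 11 ^ m * ((5 ^ 5) ^ m * (3 ^ m * ((3 * b + 1) ^ (5 * t)) ^ m))
      ≡⟨ regroup₂ (11 ^ m) ((5 ^ 5) ^ m) (3 ^ m) (((3 * b + 1) ^ (5 * t)) ^ m) ⟩
    2 * 11 ^ m * 3 ^ m * ((5 ^ 5) ^ m * ((3 * b + 1) ^ (5 * t)) ^ m)
      ≤⟨ *-monoʳ-≤ (2 * 11 ^ m * 3 ^ m) (*-^-mono-≤ {5 ^ 5} {3 ^ 5} {(3 * b + 1) ^ (5 * t)} {(3 * t) ^ (5 * t)} m 5^5*[3b+1]^5t≤3^5*[3t]^5t) ⟩
    2 * 11 ^ m * 3 ^ m * ((3 ^ 5) ^ m * ((3 * t) ^ (5 * t)) ^ m)
      ≡⟨ cong (λ p → 2 * 11 ^ m * 3 ^ m * ((3 ^ 5) ^ m * p)) (trans (sym (^N≡[^5t]^m (3 * t))) (^-distribʳ-* 3 t N)) ⟩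
    2 * 11 ^ m * 3 ^ m * ((3 ^ 5) ^ m * (3 ^ N * t ^ N))
      ≡⟨ regroup₃ (11 ^ m) (3 ^ m) ((3 ^ 5) ^ m) (3 ^ N * t ^ N) ⟩
    2 * (11 ^ m * 3 ^ m * (3 ^ 5) ^ m) * (3 ^ N * t ^ N)
      ≡⟨ cong (λ p → 2 * p * (3 ^ N * t ^ N)) (trans (^-distribʳ-* (11 * 3) (3 ^ 5) m) (cong (_* (3 ^ 5) ^ m) (^-distribʳ-* 11 3 m))) ⟨
    2 * (11 * 3 * 3 ^ 5) ^ m * (3 ^ N * t ^ N)
      <⟨ *-monoˡ-< (3 ^ N * t ^ N) {{m*n≢0 (3 ^ N) (t ^ N) {{m^n≢0 3 N}} {{m^n≢0 t N}}}} 2*8019^m<3*12500^m ⟩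
    3 * (4 * 5 ^ 5) ^ m * (3 ^ N * t ^ N)
      ≡⟨ cong (λ p → 3 * p * (3 ^ N * t ^ N)) (^-distribʳ-* 4 (5 ^ 5) m) ⟩
    3 * (4 ^ m * (5 ^ 5) ^ m) * (3 ^ N * t ^ N)
      ≡⟨ regroup₄ (4 ^ m) ((5 ^ 5) ^ m) (3 ^ N) (t ^ N) ⟩
    K * t ^ N ∎)
    where
    open ≤-Reasoning
    K L : ℕ
    K = 3 * 4 ^ m * (5 ^ 5) ^ m * 3 ^ N
    L = completions b (below m) N 0
    regroup₁ : ∀ a c d n l → 3 * a * c * d * (2 * n * l) ≡ 2 * (a * n) * (c * (d * (3 * l)))
    regroup₁ = solve-∀
    regroup₂ : ∀ e c g x → 2 * e * (c * (g * x)) ≡ 2 * e * g * (c * x)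
    regroup₂ = solve-∀
    regroup₃ : ∀ e g h x → 2 * e * g * (h * x) ≡ 2 * (e * g * h) * x
    regroup₃ = solve-∀
    regroup₄ : ∀ a c d x → 3 * (a * c) * (d * x) ≡ 3 * a * c * d * x
    regroup₄ = solve-∀
    2*8019^m<3*12500^m : 2 * (11 * 3 * 3 ^ 5) ^ m < 3 * (4 * 5 ^ 5) ^ m
    2*8019^m<3*12500^m = ≤-<-trans (*-monoʳ-≤ 2 (^-monoˡ-≤ m (≤ᵇ⇒≤ (11 * 3 * 3 ^ 5) (4 * 5 ^ 5) tt)))
                                    (*-monoˡ-< ((4 * 5 ^ 5) ^ m) {{m^n≢0 (4 * 5 ^ 5) m}} (n<1+n 2))

  bad-vertices-expected<1 : n * completions b (outside m (9 * m)) N 0 < t ^ N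
  bad-vertices-expected<1 = *-cancelˡ-< 2 (n * completions b (outside m (9 * m)) N 0) (t ^ N) (begin-strict
    2 * (n * completions b (outside m (9 * m)) N 0)
      ≡⟨ cong (λ w → 2 * (n * w)) (completions-distrib-+ b (below m) (above (9 * m)) N 0) ⟩
    2 * (n * (L + U))
      ≡⟨ split n L U ⟩
    2 * n * L + 2 * n * U
      <⟨ +-mono-<-≤ lower-tail-rare upper-tail-rare ⟩
    t ^ N + t ^ N
      ≡⟨ double (t ^ N) ⟩
    2 * t ^ N ∎)
    where
    open ≤-Reasoning
    L U : ℕ
    L = completions b (below m) N 0
    U = completions b (above (9 * m)) N 0
    split : ∀ n l u → 2 * (n * (l + u)) ≡ 2 * n * l + 2 * n * u
    split = solve-∀
    double : ∀ x → x + x ≡ 2 * x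
    double = solve-∀

lemma2 : (n : ℕ) (H : Hypergraph n) (z t c : ℕ) → 1 ≤ z → 2 ≤ t → IsCeilLn n c →
         (L : Fin n → List ℕ) → (∀ v → Unique (L v)) →
         (∀ v → length (L v) ≡ 5 * t * (z + c)) →
         (i : Fin n → Fin t) →
         ∃[ part ] (∀ v → (z + c ≤ partSize part (i v) (L v))
                         × (partSize part (i v) (L v) ≤ 9 * (z + c)))
lemma2 n H zero     t       c () _
lemma2 n H (suc z₀) zero    c _  ()
lemma2 n H (suc z₀) (suc b) c _  _ (n≤eᶜ , _) L L-unique L-length i =
  let part , no-bad-vertex = Potential.∃-zero-weight-partition (outside m (9 * m)) L i L-unique N L-length expected<1
  in  part , λ v → outside≡0⇒lo≤s≤hi m (9 * m) (partSize part (i v) (L v)) (no-bad-vertex v)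
  where
  m N : ℕ
  m = suc z₀ + c
  N = 5 * suc b * m
  expected<1 : n * completions b (outside m (9 * m)) N 0 < suc b ^ N
  expected<1 = Tails.bad-vertices-expected<1 b (z₀ + c) n (4^[k+c]*n≤11^[k+c] (suc z₀) (LeExp⇒4^c*n≤11^c n≤eᶜ))
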